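{- Applicative bisimilarity $\approx$ is a congruence: it is an equivalence relation and its open extension is compatible (preserved by $\lambda x.\cdot$, application, $\mathcal{S}k.\cdot$ and $\langle\cdot\rangle$).
   Context: The calculus $\lambda_S$: terms $t ::= v \mid t\,t \mid \mathcal{S}k.t \mid \langle t\rangle$, values $v ::= x \mid \lambda x.t$. Pure contexts $E ::= \square \mid v\,E \mid E\,t$; evaluation contexts $F ::= \square \mid v\,F \mid F\,t \mid \langle F\rangle$. Reduction: $F[(\lambda x.t)\,v] \to F[t\{v/x\}]$; $F[\langle E[\mathcal{S}k.t]\rangle] \to F[\langle t\{\lambda x.\langle E[x]\rangle/k\}\rangle]$ ($x\notin\mathrm{fv}(E)$); $F[\langle v\rangle]\to F[v]$. Labeled transition system on closed terms, with labels $\tau$, closed values $v$, and closed pure contexts $E$: $(\lambda x.t)\,v \xrightarrow{\tau} t\{v/x\}$; if $t_0\xrightarrow{\tau}t_0'$ then $t_0\,t_1\xrightarrow{\tau}t_0'\,t_1$; if $t\xrightarrow{\tau}t'$ then $v\,t\xrightarrow{\tau}v\,t'$; $\langle v\rangle\xrightarrow{\tau}v$; if $t\xrightarrow{\tau}t'$ then $\langle t\rangle\xrightarrow{\tau}\langle t'\rangle$; if $t\xrightarrow{\square}t'$ then $\langle t\rangle\xrightarrow{\tau}t'$; $\lambda x.t\xrightarrow{v}t\{v/x\}$; $\mathcal{S}k.t\xrightarrow{E}\langle t\{\lambda x.\langle E[x]\rangle/k\}\rangle$ ($x\notin\mathrm{fv}(E)$); if $t_0\xrightarrow{E[\square\,t_1]}t_0'$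 then $t_0\,t_1\xrightarrow{E}t_0'$; if $t\xrightarrow{E[v\,\square]}t'$ then $v\,t\xrightarrow{E}t'$. Weak delay transitions: $\overset{\tau}{\Rightarrow}$ is the reflexive-transitive closure of $\xrightarrow{\tau}$, and for $\alpha\neq\tau$, $\overset{\alpha}{\Rightarrow} = \overset{\tau}{\Rightarrow}\xrightarrow{\alpha}$. A relation $R$ on closed terms is an applicative simulation if $t_0\,R\,t_1$ and $t_0\xrightarrow{\alpha}t_0'$ imply there is $t_1'$ with $t_1\overset{\alpha}{\Rightarrow}t_1'$ and $t_0'\,R\,t_1'$; it is an applicative bisimulation if $R$ and $R^{ -1}$ are applicative simulations; applicative bisimilarity $\approx$ is the largest applicative bisimulation. Open extension: for open terms, $t_0\approx^\circ t_1$ iff $t_0\sigma\approx t_1\sigma$ for every substitution $\sigma$ mapping the free variables of $t_0,t_1$ to closed values. -}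

module Defs where

open import Level using (Level; suc; zero) renaming (_⊔_ to _⊔ˡ_)
open import Data.Nat using (ℕ) renaming (suc to 1+)
open import Data.Fin using (Fin) renaming (zero to fz; suc to fs)
open import Data.Product using (Σ; ∃; _×_; _,_)
open import Relation.Binary.Construct.Closure.ReflexiveTransitive using (Star)

-- Well-scoped de Bruijn syntax of λ_S.  Term n / Value n: at most n free variables.
--   t ::= v | t t | S k. t | ⟨ t ⟩        v ::= x | λ x. t
mutual
  data Value (n : ℕ) : Set where
    var : Fin n → Value n
    lam : Term (1+ n) → Value n

  data Term (n : ℕ) : Set where
    val   : Value n → Term n
    app   : Term n → Term n → Term n
    shift : Term (1+ n) → Term n         -- S k. t   (k is index 0 in the body)
    reset : Term n → Term n

data PCtx (n : ℕ) : Set where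
  hole : PCtx n
  appR : Value n → PCtx n → PCtx n
  appL : PCtx n → Term n → PCtx n

ext : ∀ {n m} → (Fin n → Fin m) → Fin (1+ n) → Fin (1+ m)
ext ρ fz     = fz
ext ρ (fs i) = fs (ρ i)

mutual
  renV : ∀ {n m} → (Fin n → Fin m) → Value n → Value m
  renV ρ (var i) = var (ρ i)
  renV ρ (lam t) = lam (ren (ext ρ) t)

  ren : ∀ {n m} → (Fin n → Fin m) → Term n → Term m
  ren ρ (val v)   = val (renV ρ v)
  ren ρ (app t u) = app (ren ρ t) (ren ρ u)
  ren ρ (shift t) = shift (ren (ext ρ) t)
  ren ρ (reset t) = reset (ren ρ t)

renC : ∀ {n m} → (Fin n → Fin m) → PCtx n → PCtx m
renC ρ hole       = hole
renC ρ (appR v E) = appR (renV ρ v) (renC ρ E)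
renC ρ (appL E t) = appL (renC ρ E) (ren ρ t)

exts : ∀ {n m} → (Fin n → Value m) → Fin (1+ n) → Value (1+ m)
exts σ fz     = var fz
exts σ (fs i) = renV fs (σ i)

mutual
  subV : ∀ {n m} → (Fin n → Value m) → Value n → Value m
  subV σ (var i) = σ i
  subV σ (lam t) = lam (sub (exts σ) t)

  sub : ∀ {n m} → (Fin n → Value m) → Term n → Term m
  sub σ (val v)   = val (subV σ v)
  sub σ (app t u) = app (sub σ t) (sub σ u)
  sub σ (shift t) = shift (sub (exts σ) t)
  sub σ (reset t) = reset (sub σ t)

single : ∀ {n} → Value n → Fin (1+ n) → Value n
single v fz     = v
single v (fs i) = var i

_[_] : ∀ {n} → Term (1+ n) → Value n → Term n
t [ v ] = sub (single v) t

plug : ∀ {n} → PCtx n → Term n → Term n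
plug hole       t = t
plug (appR v E) t = app (val v) (plug E t)
plug (appL E u) t = app (plug E t) u

_∘E_ : ∀ {n} → PCtx n → PCtx n → PCtx n
hole       ∘E E' = E'
appR v E   ∘E E' = appR v (E ∘E E')
appL E u   ∘E E' = appL (E ∘E E') u

-- the captured continuation  λ x. ⟨ E[x] ⟩   (x fresh: E is closed, weakened by one)
contK : PCtx 0 → Value 0
contK E = lam (reset (plug (renC fs E) (val (var fz))))

CTerm : Set
CTerm = Term 0

data Label : Set where
  τ    : Label
  vlab : Value 0 → Label
  clab : PCtx 0 → Label

infix 4 _—[_]→_
data _—[_]→_ : CTerm → Label → CTerm → Set where
  β      : ∀ {t v} → app (val (lam t)) (val v) —[ τ ]→ t [ v ]
  appLτ  : ∀ {t₀ t₀' t₁} → t₀ —[ τ ]→ t₀' → app t₀ t₁ —[ τ ]→ app t₀' t₁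
  appRτ  : ∀ {v t t'} → t —[ τ ]→ t' → app (val v) t —[ τ ]→ app (val v) t'
  resetV : ∀ {v} → reset (val v) —[ τ ]→ val v
  resetτ : ∀ {t t'} → t —[ τ ]→ t' → reset t —[ τ ]→ reset t'
  resetE : ∀ {t t'} → t —[ clab hole ]→ t' → reset t —[ τ ]→ t'
  lamv   : ∀ {t v} → val (lam t) —[ vlab v ]→ t [ v ]
  shiftE : ∀ {t E} → shift t —[ clab E ]→ reset (t [ contK E ])
  appLE  : ∀ {t₀ t₀' t₁ E} → t₀ —[ clab (E ∘E appL hole t₁) ]→ t₀'
           → app t₀ t₁ —[ clab E ]→ t₀'
  appRE  : ∀ {v t t' E} → t —[ clab (E ∘E appR v hole) ]→ t'
           → app (val v) t —[ clab E ]→ t'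

_—τ→_ : CTerm → CTerm → Set
t —τ→ t' = t —[ τ ]→ t'

_⇒τ_ : CTerm → CTerm → Set
_⇒τ_ = Star _—τ→_

_⇒[_]_ : CTerm → Label → CTerm → Set
t ⇒[ τ ] t'      = t ⇒τ t'
t ⇒[ vlab v ] t' = ∃ λ s → t ⇒τ s × s —[ vlab v ]→ t'
t ⇒[ clab E ] t' = ∃ λ s → t ⇒τ s × s —[ clab E ]→ t'

Rel : Set₁
Rel = CTerm → CTerm → Set

IsAppSim : Rel → Set
IsAppSim R = ∀ {t₀ t₁} → R t₀ t₁ → ∀ {α t₀'} → t₀ —[ α ]→ t₀'
             → ∃ λ t₁' → (t₁ ⇒[ α ] t₁') × R t₀' t₁'

IsAppBisim : Rel → Set
IsAppBisim R = IsAppSim R × IsAppSim (λ a b → R b a)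

infix 4 _≈_
_≈_ : CTerm → CTerm → Set₁
t₀ ≈ t₁ = Σ Rel λ R → IsAppBisim R × R t₀ t₁

infix 4 _≈°_
_≈°_ : ∀ {n} → Term n → Term n → Set₁
_≈°_ {n} t₀ t₁ = (σ : Fin n → Value 0) → sub σ t₀ ≈ sub σ t₁

-- Howe's method.  Bisimilarity lives in Set₁, so the construction is carried out relative
-- to a Set-valued bisimulation S containing the instances of the hypotheses.  Let ~ be the
-- equivalence closure of S and of τ-reduction (the latter relates a λ-abstraction to the one
-- its partner reduces to), and H Howe's closure of ~: the least compatible relation on open
-- terms absorbing ~° on the right.  H contains ~°, is closed under substitution, and (the key
-- lemma) is a simulation on closed terms up to H-related labels.  Since ~ is symmetric, the
-- converse of H is contained in its reflexive-transitive closure, which is therefore a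
-- bisimulation; compatibility of H then transfers to ≈°.
module Submission where

open import Defs
open import Data.Nat using (ℕ; suc)
open import Data.Product using (_×_)
open import Relation.Binary.Structures using (IsEquivalence)

open import Data.Fin using (Fin) renaming (zero to fz; suc to fs)
open import Data.Product using (∃; _,_; proj₁; proj₂)
open import Data.Sum using (inj₁; inj₂)
open import Function using (_∘_; flip)
open import Relation.Binary.PropositionalEquality
  using (_≡_; _≗_; refl; sym; cong; cong₂; subst₂; module ≡-Reasoning)
open import Relation.Binary.Construct.Closure.ReflexiveTransitive
  using (Star; ε; _◅_; _◅◅_; gmap; reverse; concat)
open import Relation.Binary.Construct.Closure.Symmetric using (SymClosure; fwd; bwd)
open import Relation.Binary.Construct.Closure.Equivalence using (EqClosure; symmetric)
open import Relation.Binary.Construct.Union using (_∪_)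

mutual
  renV-renV : ∀ {n m k} {ρ : Fin m → Fin k} {ρ' : Fin n → Fin m} {ρ'' : Fin n → Fin k}
    → ρ ∘ ρ' ≗ ρ'' → ∀ v → renV ρ (renV ρ' v) ≡ renV ρ'' v
  renV-renV h (var i) = cong var (h i)
  renV-renV h (lam t) = cong lam (ren-ren (ext-ext h) t)

  ren-ren : ∀ {n m k} {ρ : Fin m → Fin k} {ρ' : Fin n → Fin m} {ρ'' : Fin n → Fin k}
    → ρ ∘ ρ' ≗ ρ'' → ∀ t → ren ρ (ren ρ' t) ≡ ren ρ'' t
  ren-ren h (val v)   = cong val (renV-renV h v)
  ren-ren h (app t u) = cong₂ app (ren-ren h t) (ren-ren h u)
  ren-ren h (shift t) = cong shift (ren-ren (ext-ext h) t)
  ren-ren h (reset t) = cong reset (ren-ren h t)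

  ext-ext : ∀ {n m k} {ρ : Fin m → Fin k} {ρ' : Fin n → Fin m} {ρ'' : Fin n → Fin k}
    → ρ ∘ ρ' ≗ ρ'' → ext ρ ∘ ext ρ' ≗ ext ρ''
  ext-ext h fz     = refl
  ext-ext h (fs i) = cong fs (h i)

mutual
  subV-renV : ∀ {n m k} {σ : Fin m → Value k} {ρ : Fin n → Fin m} {σ' : Fin n → Value k}
    → σ ∘ ρ ≗ σ' → ∀ v → subV σ (renV ρ v) ≡ subV σ' v
  subV-renV h (var i) = h i
  subV-renV h (lam t) = cong lam (sub-ren (exts-ext h) t)

  sub-ren : ∀ {n m k} {σ : Fin m → Value k} {ρ : Fin n → Fin m} {σ' : Fin n → Value k}
    → σ ∘ ρ ≗ σ' → ∀ t → sub σ (ren ρ t) ≡ sub σ' t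
  sub-ren h (val v)   = cong val (subV-renV h v)
  sub-ren h (app t u) = cong₂ app (sub-ren h t) (sub-ren h u)
  sub-ren h (shift t) = cong shift (sub-ren (exts-ext h) t)
  sub-ren h (reset t) = cong reset (sub-ren h t)

  exts-ext : ∀ {n m k} {σ : Fin m → Value k} {ρ : Fin n → Fin m} {σ' : Fin n → Value k}
    → σ ∘ ρ ≗ σ' → exts σ ∘ ext ρ ≗ exts σ'
  exts-ext h fz     = refl
  exts-ext h (fs i) = cong (renV fs) (h i)

mutual
  renV-subV : ∀ {n m k} {ρ : Fin m → Fin k} {σ : Fin n → Value m} {σ' : Fin n → Value k}
    → renV ρ ∘ σ ≗ σ' → ∀ v → renV ρ (subV σ v) ≡ subV σ' v
  renV-subV h (var i) = h i
  renV-subV h (lam t) = cong lam (ren-sub (ext-exts h) t)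

  ren-sub : ∀ {n m k} {ρ : Fin m → Fin k} {σ : Fin n → Value m} {σ' : Fin n → Value k}
    → renV ρ ∘ σ ≗ σ' → ∀ t → ren ρ (sub σ t) ≡ sub σ' t
  ren-sub h (val v)   = cong val (renV-subV h v)
  ren-sub h (app t u) = cong₂ app (ren-sub h t) (ren-sub h u)
  ren-sub h (shift t) = cong shift (ren-sub (ext-exts h) t)
  ren-sub h (reset t) = cong reset (ren-sub h t)

  ext-exts : ∀ {n m k} {ρ : Fin m → Fin k} {σ : Fin n → Value m} {σ' : Fin n → Value k}
    → renV ρ ∘ σ ≗ σ' → renV (ext ρ) ∘ exts σ ≗ exts σ'
  ext-exts h fz = refl
  ext-exts {ρ = ρ} {σ} {σ'} h (fs i) = begin
    renV (ext ρ) (renV fs (σ i))  ≡⟨ renV-renV (λ _ → refl) (σ i) ⟩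
    renV (fs ∘ ρ) (σ i)           ≡⟨ sym (renV-renV (λ _ → refl) (σ i)) ⟩
    renV fs (renV ρ (σ i))        ≡⟨ cong (renV fs) (h i) ⟩
    renV fs (σ' i)                ∎
    where open ≡-Reasoning

mutual
  subV-subV : ∀ {n m k} {σ : Fin m → Value k} {σ' : Fin n → Value m} {σ'' : Fin n → Value k}
    → subV σ ∘ σ' ≗ σ'' → ∀ v → subV σ (subV σ' v) ≡ subV σ'' v
  subV-subV h (var i) = h i
  subV-subV h (lam t) = cong lam (sub-sub (exts-exts h) t)

  sub-sub : ∀ {n m k} {σ : Fin m → Value k} {σ' : Fin n → Value m} {σ'' : Fin n → Value k}
    → subV σ ∘ σ' ≗ σ'' → ∀ t → sub σ (sub σ' t) ≡ sub σ'' t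
  sub-sub h (val v)   = cong val (subV-subV h v)
  sub-sub h (app t u) = cong₂ app (sub-sub h t) (sub-sub h u)
  sub-sub h (shift t) = cong shift (sub-sub (exts-exts h) t)
  sub-sub h (reset t) = cong reset (sub-sub h t)

  exts-exts : ∀ {n m k} {σ : Fin m → Value k} {σ' : Fin n → Value m} {σ'' : Fin n → Value k}
    → subV σ ∘ σ' ≗ σ'' → subV (exts σ) ∘ exts σ' ≗ exts σ''
  exts-exts h fz = refl
  exts-exts {σ = σ} {σ'} {σ''} h (fs i) = begin
    subV (exts σ) (renV fs (σ' i))  ≡⟨ subV-renV (λ _ → refl) (σ' i) ⟩
    subV (renV fs ∘ σ) (σ' i)       ≡⟨ sym (renV-subV (λ _ → refl) (σ' i)) ⟩
    renV fs (subV σ (σ' i))         ≡⟨ cong (renV fs) (h i) ⟩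
    renV fs (σ'' i)                 ∎
    where open ≡-Reasoning

mutual
  subV-id : ∀ {n} {σ : Fin n → Value n} → σ ≗ var → ∀ v → subV σ v ≡ v
  subV-id h (var i) = h i
  subV-id h (lam t) = cong lam (sub-id (exts-id h) t)

  sub-id : ∀ {n} {σ : Fin n → Value n} → σ ≗ var → ∀ t → sub σ t ≡ t
  sub-id h (val v)   = cong val (subV-id h v)
  sub-id h (app t u) = cong₂ app (sub-id h t) (sub-id h u)
  sub-id h (shift t) = cong shift (sub-id (exts-id h) t)
  sub-id h (reset t) = cong reset (sub-id h t)

  exts-id : ∀ {n} {σ : Fin n → Value n} → σ ≗ var → exts σ ≗ var
  exts-id h fz     = refl
  exts-id h (fs i) = cong (renV fs) (h i)

mutual
  renV-as-subV : ∀ {n m} {ρ : Fin n → Fin m} {σ : Fin n → Value m}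
    → var ∘ ρ ≗ σ → ∀ v → renV ρ v ≡ subV σ v
  renV-as-subV h (var i) = h i
  renV-as-subV h (lam t) = cong lam (ren-as-sub (ext-as-exts h) t)

  ren-as-sub : ∀ {n m} {ρ : Fin n → Fin m} {σ : Fin n → Value m}
    → var ∘ ρ ≗ σ → ∀ t → ren ρ t ≡ sub σ t
  ren-as-sub h (val v)   = cong val (renV-as-subV h v)
  ren-as-sub h (app t u) = cong₂ app (ren-as-sub h t) (ren-as-sub h u)
  ren-as-sub h (shift t) = cong shift (ren-as-sub (ext-as-exts h) t)
  ren-as-sub h (reset t) = cong reset (ren-as-sub h t)

  ext-as-exts : ∀ {n m} {ρ : Fin n → Fin m} {σ : Fin n → Value m}
    → var ∘ ρ ≗ σ → var ∘ ext ρ ≗ exts σ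
  ext-as-exts h fz     = refl
  ext-as-exts h (fs i) = cong (renV fs) (h i)

clab-deterministic : ∀ {s E a b} → s —[ clab E ]→ a → s —[ clab E ]→ b → a ≡ b
clab-deterministic shiftE    shiftE    = refl
clab-deterministic (appLE x) (appLE y) = clab-deterministic x y
clab-deterministic (appLE ()) (appRE y)
clab-deterministic (appRE x) (appLE ())
clab-deterministic (appRE x) (appRE y) = clab-deterministic x y

τ-deterministic : ∀ {s a α b} → s —[ τ ]→ a → s —[ α ]→ b → α ≡ τ × a ≡ b
τ-deterministic β β = refl , refl
τ-deterministic β (appLτ ())
τ-deterministic β (appRτ ())
τ-deterministic β (appLE ())
τ-deterministic β (appRE ())
τ-deterministic (appLτ ()) β
τ-deterministic (appLτ x) (appLτ y) with τ-deterministic x y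
... | refl , refl = refl , refl
τ-deterministic (appLτ ()) (appRτ y)
τ-deterministic (appLτ x) (appLE y) with τ-deterministic x y
... | () , _
τ-deterministic (appLτ ()) (appRE y)
τ-deterministic (appRτ ()) β
τ-deterministic (appRτ x) (appLτ ())
τ-deterministic (appRτ x) (appRτ y) with τ-deterministic x y
... | refl , refl = refl , refl
τ-deterministic (appRτ x) (appLE ())
τ-deterministic (appRτ x) (appRE y) with τ-deterministic x y
... | () , _
τ-deterministic resetV resetV = refl , refl
τ-deterministic resetV (resetτ ())
τ-deterministic resetV (resetE ())
τ-deterministic (resetτ ()) resetV
τ-deterministic (resetτ x) (resetτ y) with τ-deterministic x y
... | refl , refl = refl , refl
τ-deterministic (resetτ x) (resetE y) with τ-deterministic x y
... | () , _
τ-deterministic (resetE ()) resetV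
τ-deterministic (resetE x) (resetτ y) with τ-deterministic y x
... | () , _
τ-deterministic (resetE x) (resetE y) = refl , clab-deterministic x y

weak-step : ∀ {α a b c} → a ⇒τ b → b —[ α ]→ c → a ⇒[ α ] c
weak-step {τ}      w st = w ◅◅ (st ◅ ε)
weak-step {vlab v} w st = _ , w , st
weak-step {clab E} w st = _ , w , st

weak-prefix : ∀ {α a b c} → a ⇒τ b → b ⇒[ α ] c → a ⇒[ α ] c
weak-prefix {τ}      w w'            = w ◅◅ w'
weak-prefix {vlab v} w (s , w' , st) = s , w ◅◅ w' , st
weak-prefix {clab E} w (s , w' , st) = s , w ◅◅ w' , st

appL* : ∀ {a a' b} → a ⇒τ a' → app a b ⇒τ app a' b
appL* = gmap (λ x → app x _) appLτ

appR* : ∀ {v b b'} → b ⇒τ b' → app (val v) b ⇒τ app (val v) b'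
appR* = gmap (app (val _)) appRτ

reset* : ∀ {a a'} → a ⇒τ a' → reset a ⇒τ reset a'
reset* = gmap reset resetτ

IsWeakSim : Rel → Set
IsWeakSim R = ∀ {t₀ t₁} → R t₀ t₁ → ∀ {α t₀'} → t₀ ⇒[ α ] t₀'
              → ∃ λ t₁' → (t₁ ⇒[ α ] t₁') × R t₀' t₁'

weakSim⇒appSim : ∀ {R} → IsWeakSim R → IsAppSim R
weakSim⇒appSim W r st = W r (weak-step ε st)

appSim⇒weakSim : ∀ {R} → IsAppSim R → IsWeakSim R
appSim⇒weakSim {R} S = simulate
  where
  simulate-τ* : ∀ {a b a'} → R a b → a ⇒τ a' → ∃ λ b' → b ⇒τ b' × R a' b'
  simulate-τ* r ε = _ , ε , r
  simulate-τ* r (st ◅ w) with S r st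
  ... | _ , w₁ , r₁ with simulate-τ* r₁ w
  ... | _ , w₂ , r₂ = _ , w₁ ◅◅ w₂ , r₂

  simulate-visible : ∀ {α a b s a'} → R a b → a ⇒τ s → s —[ α ]→ a'
    → ∃ λ b' → b ⇒[ α ] b' × R a' b'
  simulate-visible r w st with simulate-τ* r w
  ... | _ , w₁ , r₁ with S r₁ st
  ... | _ , w₂ , r₂ = _ , weak-prefix w₁ w₂ , r₂

  simulate : IsWeakSim R
  simulate r {τ}      w             = simulate-τ* r w
  simulate r {vlab v} (_ , w , st) = simulate-visible r w st
  simulate r {clab E} (_ , w , st) = simulate-visible r w st

weakSim-Star : ∀ {R} → IsWeakSim R → IsWeakSim (Star R)
weakSim-Star W ε        w = _ , w , ε
weakSim-Star W (r ◅ rs) w with W r w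
... | _ , w₁ , r₁ with weakSim-Star W rs w₁
... | _ , w₂ , rs₂ = _ , w₂ , r₁ ◅ rs₂

_⨾_ : Rel → Rel → Rel
(R ⨾ Q) a c = ∃ λ b → R a b × Q b c

weakSim-⨾ : ∀ {R Q} → IsWeakSim R → IsWeakSim Q → IsWeakSim (R ⨾ Q)
weakSim-⨾ WR WQ (_ , r , q) w with WR r w
... | _ , w₁ , r₁ with WQ q w₁
... | _ , w₂ , q₂ = _ , w₂ , (_ , r₁ , q₂)

appSim-∪ : ∀ {R Q} → IsAppSim R → IsAppSim Q → IsAppSim (R ∪ Q)
appSim-∪ SR SQ (inj₁ r) st with SR r st
... | _ , w , r' = _ , w , inj₁ r'
appSim-∪ SR SQ (inj₂ q) st with SQ q st
... | _ , w , q' = _ , w , inj₂ q'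

appBisim-∪ : ∀ {R Q} → IsAppBisim R → IsAppBisim Q → IsAppBisim (R ∪ Q)
appBisim-∪ (R⁺ , R⁻) (Q⁺ , Q⁻) = appSim-∪ R⁺ Q⁺ , appSim-∪ R⁻ Q⁻

appSim-⋃ : ∀ {I : Set} {R : I → Rel} → (∀ i → IsAppSim (R i))
  → IsAppSim (λ a b → ∃ λ i → R i a b)
appSim-⋃ sims (i , r) st with sims i r st
... | _ , w , r' = _ , w , (i , r')

appBisim-⋃ : ∀ {I : Set} {R : I → Rel} → (∀ i → IsAppBisim (R i))
  → IsAppBisim (λ a b → ∃ λ i → R i a b)
appBisim-⋃ {R = R} bisims =
  appSim-⋃ {R = R} (λ i → proj₁ (bisims i)) , appSim-⋃ {R = flip ∘ R} (λ i → proj₂ (bisims i))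

appSim-SymClosure : ∀ {R} → IsAppBisim R → IsAppSim (SymClosure R)
appSim-SymClosure (R⁺ , R⁻) (fwd r) st with R⁺ r st
... | _ , w , r' = _ , w , fwd r'
appSim-SymClosure (R⁺ , R⁻) (bwd r) st with R⁻ r st
... | _ , w , r' = _ , w , bwd r'

⇒τ-appBisim : IsAppBisim _⇒τ_
⇒τ-appBisim = forward , backward
  where
  forward : IsAppSim _⇒τ_
  forward ε        st = _ , weak-step ε st , ε
  forward (x ◅ w) st with τ-deterministic x st
  ... | refl , refl = _ , ε , w

  backward : IsAppSim (flip _⇒τ_)
  backward w st = _ , weak-step w st , ε

≈-refl : ∀ {t} → t ≈ t
≈-refl = _≡_ , (forward , backward) , refl
  where
  forward : IsAppSim _≡_
  forward refl st = _ , weak-step ε st , refl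

  backward : IsAppSim (flip _≡_)
  backward refl st = _ , weak-step ε st , refl

≈-sym : ∀ {t s} → t ≈ s → s ≈ t
≈-sym (R , (R⁺ , R⁻) , r) = flip R , (R⁻ , R⁺) , r

≈-trans : ∀ {t s u} → t ≈ s → s ≈ u → t ≈ u
≈-trans (R , (R⁺ , R⁻) , r) (Q , (Q⁺ , Q⁻) , q) = R ⨾ Q , (forward , backward) , (_ , r , q)
  where
  forward : IsAppSim (R ⨾ Q)
  forward = weakSim⇒appSim (weakSim-⨾ (appSim⇒weakSim R⁺) (appSim⇒weakSim Q⁺))

  backward : IsAppSim (flip (R ⨾ Q))
  backward (_ , r , q) st
    with weakSim⇒appSim (weakSim-⨾ (appSim⇒weakSim Q⁻) (appSim⇒weakSim R⁻)) (_ , q , r) st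
  ... | _ , w , (_ , q' , r') = _ , w , (_ , r' , q')

≈-isEquivalence : IsEquivalence _≈_
≈-isEquivalence = record { refl = ≈-refl ; sym = ≈-sym ; trans = ≈-trans }

module Howe (S : Rel) (S-bisim : IsAppBisim S) where

  infix 4 _~_ _~°_ _H_ _Hᴱ_ _Hᴸ_

  _~_ : Rel
  _~_ = EqClosure (S ∪ _⇒τ_)

  ~-weakSim : IsWeakSim _~_
  ~-weakSim =
    weakSim-Star (appSim⇒weakSim (appSim-SymClosure (appBisim-∪ S-bisim ⇒τ-appBisim)))

  record _~°_ {n : ℕ} (t₀ t₁ : Term n) : Set where
    constructor mk~°
    field at : (σ : Fin n → Value 0) → sub σ t₀ ~ sub σ t₁
  open _~°_

  ~°-refl : ∀ {n} {t : Term n} → t ~° t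
  ~°-refl = mk~° λ _ → ε

  ~°-sym : ∀ {n} {t s : Term n} → t ~° s → s ~° t
  ~°-sym p = mk~° λ σ → symmetric _ (at p σ)

  ~°-trans : ∀ {n} {t s u : Term n} → t ~° s → s ~° u → t ~° u
  ~°-trans p q = mk~° λ σ → at p σ ◅◅ at q σ

  ~°-sub : ∀ {n m} {t s : Term n} → t ~° s → (σ : Fin n → Value m) → sub σ t ~° sub σ s
  ~°-sub {t = t} {s} p σ = mk~° λ σ' →
    subst₂ _~_ (sym (sub-sub (λ _ → refl) t)) (sym (sub-sub (λ _ → refl) s))
      (at p (subV σ' ∘ σ))

  ~°-ren : ∀ {n m} {t s : Term n} → t ~° s → (ρ : Fin n → Fin m) → ren ρ t ~° ren ρ s
  ~°-ren {t = t} {s} p ρ =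
    subst₂ _~°_ (sym (ren-as-sub (λ _ → refl) t)) (sym (ren-as-sub (λ _ → refl) s))
      (~°-sub p (var ∘ ρ))

  ~°⇒~ : {t s : CTerm} → t ~° s → t ~ s
  ~°⇒~ {t} {s} p = subst₂ _~_ (sub-id (λ ()) t) (sub-id (λ ()) s) (at p λ ())

  ~⇒~° : {t s : CTerm} → t ~ s → t ~° s
  ~⇒~° {t} {s} p = mk~° λ σ → subst₂ _~_ (sym (sub-id (λ ()) t)) (sym (sub-id (λ ()) s)) p

  data _H_ : ∀ {n} → Term n → Term n → Set where
    hvar   : ∀ {n} {x : Fin n} {s} → val (var x) ~° s → val (var x) H s
    hlam   : ∀ {n} {t t' : Term (suc n)} {s} → t H t' → val (lam t') ~° s → val (lam t) H s
    happ   : ∀ {n} {t t' u u' s : Term n} → t H t' → u H u' → app t' u' ~° s → app t u H s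
    hshift : ∀ {n} {t t' : Term (suc n)} {s} → t H t' → shift t' ~° s → shift t H s
    hreset : ∀ {n} {t t' s : Term n} → t H t' → reset t' ~° s → reset t H s

  data _Hᴱ_ {n : ℕ} : PCtx n → PCtx n → Set where
    hhole : hole Hᴱ hole
    happR : ∀ {v v' E E'} → val v H val v' → E Hᴱ E' → appR v E Hᴱ appR v' E'
    happL : ∀ {E E' t t'} → E Hᴱ E' → t H t' → appL E t Hᴱ appL E' t'

  H-refl : ∀ {n} (t : Term n) → t H t
  H-refl (val (var x)) = hvar ~°-refl
  H-refl (val (lam t)) = hlam (H-refl t) ~°-refl
  H-refl (app t u)     = happ (H-refl t) (H-refl u) ~°-refl
  H-refl (shift t)     = hshift (H-refl t) ~°-refl
  H-refl (reset t)     = hreset (H-refl t) ~°-refl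

  Hᴱ-refl : ∀ {n} (E : PCtx n) → E Hᴱ E
  Hᴱ-refl hole       = hhole
  Hᴱ-refl (appR v E) = happR (H-refl (val v)) (Hᴱ-refl E)
  Hᴱ-refl (appL E t) = happL (Hᴱ-refl E) (H-refl t)

  H-~° : ∀ {n} {t s u : Term n} → t H s → s ~° u → t H u
  H-~° (hvar p)       q = hvar (~°-trans p q)
  H-~° (hlam h p)     q = hlam h (~°-trans p q)
  H-~° (happ h h' p)  q = happ h h' (~°-trans p q)
  H-~° (hshift h p)   q = hshift h (~°-trans p q)
  H-~° (hreset h p)   q = hreset h (~°-trans p q)

  H-~ : {t s u : CTerm} → t H s → s ~ u → t H u
  H-~ h q = H-~° h (~⇒~° q)

  ~°⊆H : ∀ {n} {t s : Term n} → t ~° s → t H s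
  ~°⊆H {t = t} p = H-~° (H-refl t) p

  S°⊆H : ∀ {n} {t s : Term n} → (∀ σ → S (sub σ t) (sub σ s)) → t H s
  S°⊆H p = ~°⊆H (mk~° λ σ → fwd (inj₁ (p σ)) ◅ ε)

  H-ren : ∀ {n m} {t t' : Term n} (ρ : Fin n → Fin m) → t H t' → ren ρ t H ren ρ t'
  H-ren ρ (hvar p)      = hvar (~°-ren p ρ)
  H-ren ρ (hlam h p)    = hlam (H-ren (ext ρ) h) (~°-ren p ρ)
  H-ren ρ (happ h h' p) = happ (H-ren ρ h) (H-ren ρ h') (~°-ren p ρ)
  H-ren ρ (hshift h p)  = hshift (H-ren (ext ρ) h) (~°-ren p ρ)
  H-ren ρ (hreset h p)  = hreset (H-ren ρ h) (~°-ren p ρ)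

  H-exts : ∀ {n m} {σ σ' : Fin n → Value m} → (∀ i → val (σ i) H val (σ' i))
    → ∀ i → val (exts σ i) H val (exts σ' i)
  H-exts hs fz     = H-refl _
  H-exts hs (fs i) = H-ren fs (hs i)

  H-sub : ∀ {n m} {t t' : Term n} {σ σ' : Fin n → Value m} → t H t'
    → (∀ i → val (σ i) H val (σ' i)) → sub σ t H sub σ' t'
  H-sub {σ' = σ'} (hvar {x = x} p) hs = H-~° (hs x) (~°-sub p σ')
  H-sub {σ' = σ'} (hlam h p)       hs = hlam (H-sub h (H-exts hs)) (~°-sub p σ')
  H-sub {σ' = σ'} (happ h h' p)    hs = happ (H-sub h hs) (H-sub h' hs) (~°-sub p σ')
  H-sub {σ' = σ'} (hshift h p)     hs = hshift (H-sub h (H-exts hs)) (~°-sub p σ')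
  H-sub {σ' = σ'} (hreset h p)     hs = hreset (H-sub h hs) (~°-sub p σ')

  H-single : ∀ {w w' : Value 0} → val w H val w' → ∀ i → val (single w i) H val (single w' i)
  H-single h fz = h

  Hᴱ-ren : ∀ {n m} {E E' : PCtx n} (ρ : Fin n → Fin m) → E Hᴱ E' → renC ρ E Hᴱ renC ρ E'
  Hᴱ-ren ρ hhole       = hhole
  Hᴱ-ren ρ (happR h e) = happR (H-ren ρ h) (Hᴱ-ren ρ e)
  Hᴱ-ren ρ (happL e h) = happL (Hᴱ-ren ρ e) (H-ren ρ h)

  H-plug : ∀ {n} {E E' : PCtx n} {t t'} → E Hᴱ E' → t H t' → plug E t H plug E' t'
  H-plug hhole        h = h
  H-plug (happR hv e) h = happ hv (H-plug e h) ~°-refl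
  H-plug (happL e hu) h = happ (H-plug e h) hu ~°-refl

  Hᴱ-∘E : ∀ {n} {E E' F F' : PCtx n} → E Hᴱ E' → F Hᴱ F' → (E ∘E F) Hᴱ (E' ∘E F')
  Hᴱ-∘E hhole       f = f
  Hᴱ-∘E (happR h e) f = happR h (Hᴱ-∘E e f)
  Hᴱ-∘E (happL e h) f = happL (Hᴱ-∘E e f) h

  H-contK : ∀ {E E' : PCtx 0} → E Hᴱ E' → val (contK E) H val (contK E')
  H-contK e = hlam (hreset (H-plug (Hᴱ-ren fs e) (H-refl _)) ~°-refl) ~°-refl

  -- Any closed value serves as a probe: answering it forces s to reduce to a λ-abstraction.
  H-lam-inv : {t : Term 1} {s : CTerm} → val (lam t) H s
    → ∃ λ q → (s ⇒τ val (lam q)) × (val (lam t) H val (lam q))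
  H-lam-inv (hlam h p) with ~-weakSim (~°⇒~ p) {vlab (lam (val (var fz)))} (weak-step ε lamv)
  ... | _ , (_ , w , lamv) , _ = _ , w , hlam h (~⇒~° (~°⇒~ p ◅◅ (fwd (inj₂ w) ◅ ε)))

  H-value-inv : {v : Value 0} {s : CTerm} → val v H s
    → ∃ λ q → (s ⇒τ val (lam q)) × (val v H val (lam q))
  H-value-inv {lam t} h = H-lam-inv h

  ~-lam-β : ∀ {a b : Term 1} → val (lam a) ~ val (lam b) → ∀ w → (a [ w ]) ~ (b [ w ])
  ~-lam-β p w with ~-weakSim p {vlab w} (weak-step ε lamv)
  ... | _ , (_ , ε , lamv) , q = q
  ... | _ , (_ , () ◅ _ , _) , _

  H-β : ∀ {t q : Term 1} {w w' : Value 0} → val (lam t) H val (lam q) → val w H val w'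
    → (t [ w ]) H (q [ w' ])
  H-β {w' = w'} (hlam h p) hw = H-~ (H-sub h (H-single hw)) (~-lam-β (~°⇒~ p) w')

  data _Hᴸ_ : Label → Label → Set where
    hτ : τ Hᴸ τ
    hv : ∀ {v₀ v₁} → val v₀ H val v₁ → vlab v₀ Hᴸ vlab v₁
    hc : ∀ {E₀ E₁} → E₀ Hᴱ E₁ → clab E₀ Hᴸ clab E₁

  Hᴸ-refl : ∀ α → α Hᴸ α
  Hᴸ-refl τ        = hτ
  Hᴸ-refl (vlab v) = hv (H-refl _)
  Hᴸ-refl (clab E) = hc (Hᴱ-refl E)

  close : ∀ {α} {t₀' s s' t₁ : CTerm} → t₀' H s' → s ⇒[ α ] s' → s ~ t₁
    → ∃ λ t₁' → (t₁ ⇒[ α ] t₁') × (t₀' H t₁')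
  close h w q with ~-weakSim q w
  ... | t₁' , w' , q' = t₁' , w' , H-~ h q'

  H-simulates : ∀ {t₀ t₁ : CTerm} {α α₁ t₀'} → t₀ H t₁ → t₀ —[ α ]→ t₀' → α Hᴸ α₁
    → ∃ λ t₁' → (t₁ ⇒[ α₁ ] t₁') × (t₀' H t₁')
  H-simulates (happ ha hb p) β hτ with H-value-inv hb | H-lam-inv ha
  ... | _ , wb , hv' | _ , wa , hl =
    close (H-β hl hv') (appL* wa ◅◅ appR* wb ◅◅ (β ◅ ε)) (~°⇒~ p)
  H-simulates (happ ha hb p) (appLτ st) hτ with H-simulates ha st hτ
  ... | _ , w , h' = close (happ h' hb ~°-refl) (appL* w) (~°⇒~ p)
  H-simulates (happ ha hb p) (appRτ st) hτ with H-value-inv ha | H-simulates hb st hτ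
  ... | _ , wa , hv' | _ , w , h' = close (happ hv' h' ~°-refl) (appL* wa ◅◅ appR* w) (~°⇒~ p)
  H-simulates (hreset h p) resetV hτ with H-value-inv h
  ... | _ , w , hv' = close hv' (reset* w ◅◅ (resetV ◅ ε)) (~°⇒~ p)
  H-simulates (hreset h p) (resetτ st) hτ with H-simulates h st hτ
  ... | _ , w , h' = close (hreset h' ~°-refl) (reset* w) (~°⇒~ p)
  H-simulates (hreset h p) (resetE st) hτ with H-simulates h st (hc hhole)
  ... | _ , (_ , w , st') , h' = close h' (reset* w ◅◅ (resetE st' ◅ ε)) (~°⇒~ p)
  H-simulates h lamv (hv hw) with H-lam-inv h
  ... | _ , w , hl = _ , (_ , w , lamv) , H-β hl hw
  H-simulates (hshift h p) shiftE (hc {E₁ = E₁} e) =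
    close {α = clab E₁} (hreset (H-sub h (H-single (H-contK e))) ~°-refl) (_ , ε , shiftE) (~°⇒~ p)
  H-simulates (happ ha hb p) (appLE st) (hc {E₁ = E₁} e)
    with H-simulates ha st (hc (Hᴱ-∘E e (happL hhole hb)))
  ... | _ , (_ , w , st') , h' = close {α = clab E₁} h' (_ , appL* w , appLE st') (~°⇒~ p)
  H-simulates (happ ha hb p) (appRE st) (hc {E₁ = E₁} e) with H-value-inv ha
  ... | _ , wa , hv' with H-simulates hb st (hc (Hᴱ-∘E e (happR hv' hhole)))
  ... | _ , (_ , w , st') , h' =
    close {α = clab E₁} h' (_ , appL* wa ◅◅ appR* w , appRE st') (~°⇒~ p)

  H-appSim : IsAppSim _H_
  H-appSim h st = H-simulates h st (Hᴸ-refl _)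

  H-converse : ∀ {n} {t s : Term n} → t H s → Star _H_ s t
  H-converse (hvar p)     = ~°⊆H (~°-sym p) ◅ ε
  H-converse (hlam h p) =
    ~°⊆H (~°-sym p) ◅ gmap (val ∘ lam) (λ h → hlam h ~°-refl) (H-converse h)
  H-converse {t = app t u} (happ {t' = t'} {u' = u'} h h' p) =
    ~°⊆H (~°-sym p) ◅
      (gmap (λ x → app x u') (λ h → happ h (H-refl u') ~°-refl) (H-converse h)
       ◅◅ gmap (app t) (λ h → happ (H-refl t) h ~°-refl) (H-converse h'))
  H-converse (hshift h p) = ~°⊆H (~°-sym p) ◅ gmap shift (λ h → hshift h ~°-refl) (H-converse h)
  H-converse (hreset h p) = ~°⊆H (~°-sym p) ◅ gmap reset (λ h → hreset h ~°-refl) (H-converse h)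

  Star-H-sym : ∀ {n} {t s : Term n} → Star _H_ t s → Star _H_ s t
  Star-H-sym = concat ∘ reverse H-converse

  Star-H-appBisim : IsAppBisim (Star _H_)
  Star-H-appBisim = forward , backward
    where
    forward : IsAppSim (Star _H_)
    forward = weakSim⇒appSim (weakSim-Star (appSim⇒weakSim H-appSim))

    backward : IsAppSim (flip (Star _H_))
    backward r st with forward (Star-H-sym r) st
    ... | _ , w , r' = _ , w , Star-H-sym r'

  H⇒≈° : ∀ {n} {t s : Term n} → t H s → t ≈° s
  H⇒≈° h σ = Star _H_ , Star-H-appBisim , H-sub h (λ _ → H-refl _) ◅ ε

≈°-witness : ∀ {n} {t s : Term n} → t ≈° s → Rel
≈°-witness p a b = ∃ λ σ → proj₁ (p σ) a b

≈°-witness-appBisim : ∀ {n} {t s : Term n} (p : t ≈° s) → IsAppBisim (≈°-witness p)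
≈°-witness-appBisim p = appBisim-⋃ (λ σ → proj₁ (proj₂ (p σ)))

≈°-witness-relates : ∀ {n} {t s : Term n} (p : t ≈° s) → ∀ σ → ≈°-witness p (sub σ t) (sub σ s)
≈°-witness-relates p σ = σ , proj₂ (proj₂ (p σ))

≈°-lam : ∀ {n : ℕ} {t₀ t₁ : Term (suc n)} → t₀ ≈° t₁ → val (lam t₀) ≈° val (lam t₁)
≈°-lam p = H⇒≈° (hlam (S°⊆H (≈°-witness-relates p)) ~°-refl)
  where open Howe (≈°-witness p) (≈°-witness-appBisim p)

≈°-shift : ∀ {n : ℕ} {t₀ t₁ : Term (suc n)} → t₀ ≈° t₁ → shift t₀ ≈° shift t₁
≈°-shift p = H⇒≈° (hshift (S°⊆H (≈°-witness-relates p)) ~°-refl)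
  where open Howe (≈°-witness p) (≈°-witness-appBisim p)

≈°-reset : ∀ {n : ℕ} {t₀ t₁ : Term n} → t₀ ≈° t₁ → reset t₀ ≈° reset t₁
≈°-reset p = H⇒≈° (hreset (S°⊆H (≈°-witness-relates p)) ~°-refl)
  where open Howe (≈°-witness p) (≈°-witness-appBisim p)

≈°-app : ∀ {n : ℕ} {t₀ t₁ s₀ s₁ : Term n} → t₀ ≈° t₁ → s₀ ≈° s₁ → app t₀ s₀ ≈° app t₁ s₁
≈°-app p q = H⇒≈° (happ (S°⊆H (inj₁ ∘ ≈°-witness-relates p))
                        (S°⊆H (inj₂ ∘ ≈°-witness-relates q)) ~°-refl)
  where
  open Howe (≈°-witness p ∪ ≈°-witness q)
            (appBisim-∪ (≈°-witness-appBisim p) (≈°-witness-appBisim q))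

theorem4p14 : IsEquivalence _≈_
    × (∀ {n : ℕ} {t₀ t₁ : Term (suc n)} → t₀ ≈° t₁ → val (lam t₀) ≈° val (lam t₁))
    × (∀ {n : ℕ} {t₀ t₁ s₀ s₁ : Term n} → t₀ ≈° t₁ → s₀ ≈° s₁ → app t₀ s₀ ≈° app t₁ s₁)
    × (∀ {n : ℕ} {t₀ t₁ : Term (suc n)} → t₀ ≈° t₁ → shift t₀ ≈° shift t₁)
    × (∀ {n : ℕ} {t₀ t₁ : Term n} → t₀ ≈° t₁ → reset t₀ ≈° reset t₁)
theorem4p14 = ≈-isEquivalence , ≈°-lam , ≈°-app , ≈°-shift , ≈°-reset
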